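{- Let $f(z),g(z),h(z)$ be transitions in parallel, and let $\mathcal{M}_{\mathrm{BLin}}$ be the bilinear infinite counting automaton with states $\mathbb{Z}$, initial state $0$, final states $\{0\}$, a loop labelled $h(z)$ at every state, and for every $i\ge0$ transitions from $i$ to $i+1$ and from $-(i+1)$ to $-i$ labelled $f(z)$, and transitions from $i+1$ to $i$ and from $-i$ to $-(i+1)$ labelled $g(z)$. Then its generating function is $$B_b(z)=\frac{1}{\sqrt{(1-h(z))^2-4f(z)g(z)}}=\cfrac{1}{1-h(z)-\cfrac{2f(z)g(z)}{1-h(z)-\cfrac{f(z)g(z)}{1-h(z)-\cfrac{f(z)g(z)}{\ddots}}}}.$$
   Context: A transition in parallel labelled $f(z)=\sum_{n\ge1}f_nz^n$ ($f_n\in\mathbb{N}$, zero constant term) from state $p$ to state $q$ stands for: for each $n\ge1$, $f_n$ disjoint chains of $n$ transitions labelled $z$ from $p$ to $q$ through $n-1$ new hidden non-final states, from each of which only the next transition of the chain starts. The generating function of a counting automaton is $\sum_n a_nz^n$ with $a_n$ the number of paths of $n$ transitions (all transitions in parallel expanded) from the initial state to a final state. The square root is the formal power series square root with constant term $1$; the continued fraction is the coefficientwise limit of its truncations. -}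

module Defs where

open import Data.Nat using (ℕ; zero; suc; _∸_; _≤_)
open import Data.Integer as ℤ using (ℤ; +_; -_; 0ℤ; 1ℤ)
open import Data.Fin using (Fin; zero; suc; inject₁; fromℕ)

Series : Set
Series = ℕ → ℤ

↑ : (ℕ → ℕ) → Series
↑ a n = + (a n)

one : Series
one zero    = 1ℤ
one (suc _) = 0ℤ

_⊕_ : Series → Series → Series
(A ⊕ B) n = A n ℤ.+ B n

_⊖_ : Series → Series → Series
(A ⊖ B) n = A n ℤ.- B n

_·_ : ℤ → Series → Series
(c · A) n = c ℤ.* A n

sumTo : ℕ → (ℕ → ℤ) → ℤ
sumTo zero    u = u zero
sumTo (suc n) u = sumTo n u ℤ.+ u (suc n)

_⊛_ : Series → Series → Series
(A ⊛ B) n = sumTo n (λ i → A i ℤ.* B (n ∸ i))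

pow : Series → ℕ → Series
pow A zero    = one
pow A (suc m) = A ⊛ pow A m

-- Multiplicative inverse of a series D with constant term 1:
-- 1/D = Σ_m (1 - D)^m ; since (1-D) has zero constant term, only
-- m ≤ n contribute to the n-th coefficient.
inv : Series → Series
inv D n = sumTo n (λ m → pow (one ⊖ D) m n)

module BLin (f g h : ℕ → ℕ) where

  data Edge : Set where
    up⁺   : ℕ → Edge
    up⁻   : ℕ → Edge
    down⁺ : ℕ → Edge
    down⁻ : ℕ → Edge
    loop  : ℤ → Edge

  src : Edge → ℤ
  src (up⁺ i)   = + i
  src (up⁻ i)   = - (+ suc i)
  src (down⁺ i) = + suc i
  src (down⁻ i) = - (+ i)
  src (loop j)  = j

  tgt : Edge → ℤ
  tgt (up⁺ i)   = + suc i
  tgt (up⁻ i)   = - (+ i)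
  tgt (down⁺ i) = + i
  tgt (down⁻ i) = - (+ suc i)
  tgt (loop j)  = j

  lab : Edge → ℕ → ℕ
  lab (up⁺ _)   = f
  lab (up⁻ _)   = f
  lab (down⁺ _) = g
  lab (down⁻ _) = g
  lab (loop _)  = h

  -- States of the expanded automaton: the states ℤ of M_BLin, plus, for every
  -- edge e, every chain length 2+m (m ∈ ℕ) and every chain index
  -- k < lab e (2+m), the m+1 hidden states of that chain (position r+1, r ≤ m).
  data State : Set where
    int : ℤ → State
    hid : (e : Edge) (m : ℕ) (k : Fin (lab e (suc (suc m)))) (r : Fin (suc m)) → State

  -- Transitions of the expanded automaton (proof-relevant: distinct
  -- parallel transitions are distinct elements).
  data Step : State → State → Set where
    single : (e : Edge) (k : Fin (lab e 1)) → Step (int (src e)) (int (tgt e))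
    enter  : (e : Edge) (m : ℕ) (k : Fin (lab e (suc (suc m)))) →
             Step (int (src e)) (hid e m k zero)
    move   : (e : Edge) (m : ℕ) (k : Fin (lab e (suc (suc m)))) (r : Fin m) →
             Step (hid e m k (inject₁ r)) (hid e m k (suc r))
    exit   : (e : Edge) (m : ℕ) (k : Fin (lab e (suc (suc m)))) →
             Step (hid e m k (fromℕ m)) (int (tgt e))

  data Path : State → State → ℕ → Set where
    []  : ∀ {s} → Path s s 0
    _∷_ : ∀ {s t u n} → Step s t → Path t u n → Path s u (suc n)

  AccPath : ℕ → Set
  AccPath n = Path (int 0ℤ) (int 0ℤ) n

module Formulas (f g h : ℕ → ℕ) where

  F G H : Series
  F = ↑ f
  G = ↑ g
  H = ↑ h

  radicand : Series
  radicand = ((one ⊖ H) ⊛ (one ⊖ H)) ⊖ ((+ 4) · (F ⊛ G))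

  -- tails of the continued fraction:  D 0 = 1 - h,
  -- D (k+1) = 1 - h - f g / D k
  D : ℕ → Series
  D zero    = one ⊖ H
  D (suc k) = (one ⊖ H) ⊖ ((F ⊛ G) ⊛ inv (D k))

  truncCF : ℕ → Series
  truncCF k = inv ((one ⊖ H) ⊖ ((+ 2) · ((F ⊛ G) ⊛ inv (D k))))

-- Let W x be the generating function of the paths from state x to the final state 0.
-- Splitting off the chain that contains the first transition gives the system
--   W x = [x = 0] + h W x + f W (x + 1) + g W (x − 1),
-- which is contractive because f, g, h have no constant term, so it has at most one
-- solution. Let M be the limit of the continued-fraction tails, so that
-- M (1 − h − f g M) = 1, and B = 1 / (1 − h − 2 f g M). Then x ↦ B (M g)^x for x ≥ 0
-- and x ↦ B (M f)^(−x) for x < 0 solves the system (M g counts first passages from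
-- x + 1 down to x), hence W 0 = B. The identity for M gives
-- (1 − h − 2 f g M)² = (1 − h)² − 4 f g, and the k-th truncation of the continued
-- fraction agrees with B below order k + 1 since each level of the fraction gains one order.

module Submission where

open import Defs
open import Data.Nat using (ℕ; _≤_)
open import Data.Integer using (ℤ; +_; 1ℤ)
open import Data.Fin using (Fin)
open import Data.Product using (Σ; _×_; ∃)
open import Function.Bundles using (_↔_)
open import Relation.Binary.PropositionalEquality using (_≡_)

open import Algebra.Bundles using (CommutativeRing)
import Algebra.Solver.Ring as RingSolver
open import Algebra.Solver.Ring.AlmostCommutativeRing using (fromCommutativeRing; _-Raw-AlmostCommutative⟶_)
open import Axiom.UniquenessOfIdentityProofs using (module Decidable⇒UIP)
open import Data.Empty using (⊥; ⊥-elim)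
open import Data.Fin using (zero; suc; inject₁; fromℕ; toℕ)
import Data.Fin.Properties as Fin
open import Data.Integer as ℤ using (-[1+_]; 0ℤ)
import Data.Integer.Properties as ℤ
open import Data.Integer.Tactic.RingSolver using (solve-∀)
open import Data.Maybe using (Maybe; just; nothing)
open import Data.Nat as ℕ using (zero; suc; _<_; _∸_; z≤n; s≤s)
import Data.Nat.Properties as ℕ
open import Data.Product using (_,_)
open import Data.Product.Function.Dependent.Propositional using (Σ-↔)
open import Data.Product.Function.NonDependent.Propositional using (_×-↔_)
open import Data.Sum using (_⊎_; inj₁; inj₂)
open import Data.Sum.Function.Propositional using (_⊎-↔_)
open import Function.Bundles using (mk↔ₛ′)
open import Function.Properties.Inverse using (↔-refl; ↔-sym; ↔-trans)
open import Function.Related.Propositional using (module EquationalReasoning; bijection)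
open import Relation.Binary.PropositionalEquality
  using (refl; sym; trans; cong; cong₂; subst; module ≡-Reasoning)
import Relation.Binary.Reasoning.Setoid as SetoidReasoning
open import Relation.Nullary using (yes; no)

-- The ring of formal power series

sumTo-cong : ∀ n {u v : ℕ → ℤ} → (∀ i → i ≤ n → u i ≡ v i) → sumTo n u ≡ sumTo n v
sumTo-cong zero    u≗v = u≗v 0 z≤n
sumTo-cong (suc n) u≗v =
  cong₂ ℤ._+_ (sumTo-cong n (λ i i≤n → u≗v i (ℕ.m≤n⇒m≤1+n i≤n))) (u≗v (suc n) ℕ.≤-refl)

sumTo-sucˡ : ∀ n u → sumTo (suc n) u ≡ u 0 ℤ.+ sumTo n (λ i → u (suc i))
sumTo-sucˡ zero    u = refl
sumTo-sucˡ (suc n) u =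
  trans (cong (ℤ._+ u (suc (suc n))) (sumTo-sucˡ n u)) (ℤ.+-assoc (u 0) _ _)

sumTo-+ : ∀ n u v → sumTo n (λ i → u i ℤ.+ v i) ≡ sumTo n u ℤ.+ sumTo n v
sumTo-+ zero    u v = refl
sumTo-+ (suc n) u v =
  trans (cong (ℤ._+ (u (suc n) ℤ.+ v (suc n))) (sumTo-+ n u v))
        (interchange (sumTo n u) (sumTo n v) (u (suc n)) (v (suc n)))
  where
  interchange : ∀ a b c d → (a ℤ.+ b) ℤ.+ (c ℤ.+ d) ≡ (a ℤ.+ c) ℤ.+ (b ℤ.+ d)
  interchange = solve-∀

sumTo-*ˡ : ∀ n c u → sumTo n (λ i → c ℤ.* u i) ≡ c ℤ.* sumTo n u
sumTo-*ˡ zero    c u = refl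
sumTo-*ˡ (suc n) c u =
  trans (cong (ℤ._+ (c ℤ.* u (suc n))) (sumTo-*ˡ n c u)) (sym (ℤ.*-distribˡ-+ c _ _))

sumTo-zero : ∀ n u → (∀ i → i ≤ n → u i ≡ 0ℤ) → sumTo n u ≡ 0ℤ
sumTo-zero zero    u u≡0 = u≡0 0 z≤n
sumTo-zero (suc n) u u≡0 =
  cong₂ ℤ._+_ (sumTo-zero n u (λ i i≤n → u≡0 i (ℕ.m≤n⇒m≤1+n i≤n))) (u≡0 (suc n) ℕ.≤-refl)

sumTo-reverse : ∀ n u → sumTo n u ≡ sumTo n (λ i → u (n ∸ i))
sumTo-reverse zero    u = refl
sumTo-reverse (suc n) u =
  trans (cong (ℤ._+ u (suc n)) (sumTo-reverse n u))
  (trans (ℤ.+-comm (sumTo n (λ i → u (n ∸ i))) (u (suc n)))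
         (sym (sumTo-sucˡ n (λ i → u (suc n ∸ i)))))

infix 4 _≋_
_≋_ : Series → Series → Set
A ≋ B = ∀ n → A n ≡ B n

0S : Series
0S _ = 0ℤ

neg : Series → Series
neg A n = ℤ.- A n

tail : Series → Series
tail A n = A (suc n)

cst : ℤ → Series
cst c zero    = c
cst c (suc n) = 0ℤ

⊛-suc : ∀ A B n → (A ⊛ B) (suc n) ≡ A 0 ℤ.* B (suc n) ℤ.+ (tail A ⊛ B) n
⊛-suc A B n = sumTo-sucˡ n _

⊛-cong : ∀ {A A′ B B′} → A ≋ A′ → B ≋ B′ → (A ⊛ B) ≋ (A′ ⊛ B′)
⊛-cong A≋A′ B≋B′ n = sumTo-cong n (λ i _ → cong₂ ℤ._*_ (A≋A′ i) (B≋B′ (n ∸ i)))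

⊛-comm : ∀ A B → (A ⊛ B) ≋ (B ⊛ A)
⊛-comm A B n = trans (sumTo-reverse n _) (sumTo-cong n λ i i≤n →
  trans (cong (λ k → A (n ∸ i) ℤ.* B k) (ℕ.m∸[m∸n]≡n i≤n)) (ℤ.*-comm (A (n ∸ i)) (B i)))

⊛-distribʳ-⊕ : ∀ A A′ B → ((A ⊕ A′) ⊛ B) ≋ ((A ⊛ B) ⊕ (A′ ⊛ B))
⊛-distribʳ-⊕ A A′ B n =
  trans (sumTo-cong n (λ i _ → ℤ.*-distribʳ-+ (B (n ∸ i)) (A i) (A′ i))) (sumTo-+ n _ _)

⊛-·ˡ : ∀ c A B → ((c · A) ⊛ B) ≋ (c · (A ⊛ B))
⊛-·ˡ c A B n = trans (sumTo-cong n (λ i _ → ℤ.*-assoc c (A i) _)) (sumTo-*ˡ n c _)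

⊛-zeroˡ : ∀ B → (0S ⊛ B) ≋ 0S
⊛-zeroˡ B n = sumTo-zero n _ (λ i _ → ℤ.*-zeroˡ (B (n ∸ i)))

⊛-assoc : ∀ A B C → ((A ⊛ B) ⊛ C) ≋ (A ⊛ (B ⊛ C))
⊛-assoc A B C zero    = ℤ.*-assoc (A 0) (B 0) (C 0)
⊛-assoc A B C (suc n) = begin
  ((A ⊛ B) ⊛ C) (suc n)
    ≡⟨ ⊛-suc (A ⊛ B) C n ⟩
  a₀ ℤ.* B 0 ℤ.* C (suc n) ℤ.+ (tail (A ⊛ B) ⊛ C) n
    ≡⟨ cong (λ z → lead ℤ.+ z) (⊛-cong {B = C} (⊛-suc A B) (λ _ → refl) n) ⟩
  a₀ ℤ.* B 0 ℤ.* C (suc n) ℤ.+ (((a₀ · tail B) ⊕ (tail A ⊛ B)) ⊛ C) n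
    ≡⟨ cong (λ z → lead ℤ.+ z)
         (trans (⊛-distribʳ-⊕ (a₀ · tail B) (tail A ⊛ B) C n)
                (cong (ℤ._+ ((tail A ⊛ B) ⊛ C) n) (⊛-·ˡ a₀ (tail B) C n))) ⟩
  a₀ ℤ.* B 0 ℤ.* C (suc n) ℤ.+ (a₀ ℤ.* (tail B ⊛ C) n ℤ.+ ((tail A ⊛ B) ⊛ C) n)
    ≡⟨ factor a₀ (B 0) (C (suc n)) _ _ ⟩
  a₀ ℤ.* (B 0 ℤ.* C (suc n) ℤ.+ (tail B ⊛ C) n) ℤ.+ ((tail A ⊛ B) ⊛ C) n
    ≡⟨ cong₂ (λ u v → a₀ ℤ.* u ℤ.+ v) (sym (⊛-suc B C n)) (⊛-assoc (tail A) B C n) ⟩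
  a₀ ℤ.* (B ⊛ C) (suc n) ℤ.+ (tail A ⊛ (B ⊛ C)) n
    ≡⟨ sym (⊛-suc A (B ⊛ C) n) ⟩
  (A ⊛ (B ⊛ C)) (suc n) ∎
  where
  open ≡-Reasoning
  a₀ = A 0
  lead = a₀ ℤ.* B 0 ℤ.* C (suc n)
  factor : ∀ a b c x y → a ℤ.* b ℤ.* c ℤ.+ (a ℤ.* x ℤ.+ y) ≡ a ℤ.* (b ℤ.* c ℤ.+ x) ℤ.+ y
  factor = solve-∀

⊛-identityˡ : ∀ A → (one ⊛ A) ≋ A
⊛-identityˡ A zero    = ℤ.*-identityˡ (A 0)
⊛-identityˡ A (suc n) = trans (⊛-suc one A n)
  (trans (cong₂ ℤ._+_ (ℤ.*-identityˡ (A (suc n))) (⊛-zeroˡ A n)) (ℤ.+-identityʳ _))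

⊛-identityʳ : ∀ A → (A ⊛ one) ≋ A
⊛-identityʳ A n = trans (⊛-comm A one n) (⊛-identityˡ A n)

seriesRing : CommutativeRing _ _
seriesRing = record
  { Carrier = Series
  ; _≈_ = _≋_
  ; _+_ = _⊕_
  ; _*_ = _⊛_
  ; -_ = neg
  ; 0# = 0S
  ; 1# = one
  ; isCommutativeRing = record
    { isRing = record
      { +-isAbelianGroup = record
        { isGroup = record
          { isMonoid = record
            { isSemigroup = record
              { isMagma = record
                { isEquivalence = record
                  { refl = λ _ → refl
                  ; sym = λ A≋B n → sym (A≋B n)
                  ; trans = λ A≋B B≋C n → trans (A≋B n) (B≋C n) }
                ; ∙-cong = λ A≋A′ B≋B′ n → cong₂ ℤ._+_ (A≋A′ n) (B≋B′ n) }
              ; assoc = λ A B C n → ℤ.+-assoc (A n) (B n) (C n) }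
            ; identity = (λ A n → ℤ.+-identityˡ (A n)) , (λ A n → ℤ.+-identityʳ (A n)) }
          ; inverse = (λ A n → ℤ.+-inverseˡ (A n)) , (λ A n → ℤ.+-inverseʳ (A n))
          ; ⁻¹-cong = λ A≋B n → cong ℤ.-_ (A≋B n) }
        ; comm = λ A B n → ℤ.+-comm (A n) (B n) }
      ; *-cong = ⊛-cong
      ; *-assoc = ⊛-assoc
      ; *-identity = ⊛-identityˡ , ⊛-identityʳ
      ; distrib = (λ A B C → ≋-trans (⊛-comm A (B ⊕ C)) (≋-trans (⊛-distribʳ-⊕ B C A)
                              (λ n → cong₂ ℤ._+_ (⊛-comm B A n) (⊛-comm C A n))))
                , (λ A B C → ⊛-distribʳ-⊕ B C A) }
    ; *-comm = ⊛-comm } }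
  where
  ≋-trans : ∀ {A B C} → A ≋ B → B ≋ C → A ≋ C
  ≋-trans A≋B B≋C n = trans (A≋B n) (B≋C n)

open CommutativeRing seriesRing
  using (setoid; +-cong; *-cong; -‿cong; distribˡ)
  renaming (refl to ≋-refl; sym to ≋-sym; trans to ≋-trans)

cst-⊛ : ∀ c A → (cst c ⊛ A) ≋ (c · A)
cst-⊛ c A zero    = refl
cst-⊛ c A (suc n) = trans (⊛-suc (cst c) A n)
  (trans (cong (λ z → c ℤ.* A (suc n) ℤ.+ z) tail-vanishes) (ℤ.+-identityʳ _))
  where
  tail-vanishes : (tail (cst c) ⊛ A) n ≡ 0ℤ
  tail-vanishes = trans (⊛-cong {tail (cst c)} {B = A} (λ _ → refl) (λ _ → refl) n) (⊛-zeroˡ A n)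

cst-homomorphism : CommutativeRing.rawRing ℤ.+-*-commutativeRing
                     -Raw-AlmostCommutative⟶ fromCommutativeRing seriesRing
cst-homomorphism = record
  { ⟦_⟧ = cst
  ; +-homo = λ a b → λ { zero → refl ; (suc n) → refl }
  ; *-homo = λ a b → λ { zero → refl
                       ; (suc n) → trans (sym (ℤ.*-zeroʳ a)) (sym (cst-⊛ a (cst b) (suc n))) }
  ; -‿homo = λ a → λ { zero → refl ; (suc n) → refl }
  ; 0-homo = λ { zero → refl ; (suc n) → refl }
  ; 1-homo = λ { zero → refl ; (suc n) → refl }
  }

cst-equal? : ∀ a b → Maybe (cst a ≋ cst b)
cst-equal? a b with a ℤ.≟ b
... | yes refl = just ≋-refl
... | no _     = nothing

open RingSolver (CommutativeRing.rawRing ℤ.+-*-commutativeRing) (fromCommutativeRing seriesRing)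
                cst-homomorphism cst-equal?
  using (solve; _:=_; _:+_; _:*_; _:-_; con)

cst-one : cst 1ℤ ≋ one
cst-one zero    = refl
cst-one (suc n) = refl

-- Agreement of coefficients below a given order

Agree : ℕ → Series → Series → Set
Agree n A B = ∀ i → i < n → A i ≡ B i

Agree-refl : ∀ {n A} → Agree n A A
Agree-refl _ _ = refl

⊛-coefficient-cong : ∀ i {A A′ B B′} → (∀ j → j ≤ i → A j ≡ A′ j) → (∀ j → j ≤ i → B j ≡ B′ j) →
                     (A ⊛ B) i ≡ (A′ ⊛ B′) i
⊛-coefficient-cong i A≡A′ B≡B′ =
  sumTo-cong i (λ j j≤i → cong₂ ℤ._*_ (A≡A′ j j≤i) (B≡B′ (i ∸ j) (ℕ.m∸n≤m i j)))

⊛-Agree : ∀ n {A A′ B B′} → Agree n A A′ → Agree n B B′ → Agree n (A ⊛ B) (A′ ⊛ B′)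
⊛-Agree n A≈A′ B≈B′ i i<n = ⊛-coefficient-cong i
  (λ j j≤i → A≈A′ j (ℕ.≤-<-trans j≤i i<n)) (λ j j≤i → B≈B′ j (ℕ.≤-<-trans j≤i i<n))

⊛-Agree-suc : ∀ n P {B B′} → P 0 ≡ 0ℤ → Agree n B B′ → Agree (suc n) (P ⊛ B) (P ⊛ B′)
⊛-Agree-suc n P {B} {B′} P₀≡0 B≈B′ zero    _ =
  trans (cong (ℤ._* B 0) P₀≡0) (sym (cong (ℤ._* B′ 0) P₀≡0))
⊛-Agree-suc n P {B} {B′} P₀≡0 B≈B′ (suc i) (s≤s i<n) = begin
  (P ⊛ B) (suc i)                          ≡⟨ ⊛-suc P B i ⟩
  P 0 ℤ.* B (suc i) ℤ.+ (tail P ⊛ B) i     ≡⟨ cong₂ ℤ._+_ lead tail-agree ⟩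
  P 0 ℤ.* B′ (suc i) ℤ.+ (tail P ⊛ B′) i   ≡⟨ sym (⊛-suc P B′ i) ⟩
  (P ⊛ B′) (suc i)                         ∎
  where
  open ≡-Reasoning
  lead : P 0 ℤ.* B (suc i) ≡ P 0 ℤ.* B′ (suc i)
  lead = trans (cong (ℤ._* B (suc i)) P₀≡0) (sym (cong (ℤ._* B′ (suc i)) P₀≡0))
  tail-agree : (tail P ⊛ B) i ≡ (tail P ⊛ B′) i
  tail-agree = ⊛-coefficient-cong i {tail P} {tail P}
                 (λ _ _ → refl) (λ j j≤i → B≈B′ j (ℕ.≤-<-trans j≤i i<n))

⊕-Agree : ∀ n {A A′ B B′} → Agree n A A′ → Agree n B B′ → Agree n (A ⊕ B) (A′ ⊕ B′)
⊕-Agree n A≈A′ B≈B′ i i<n = cong₂ ℤ._+_ (A≈A′ i i<n) (B≈B′ i i<n)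

⊖-Agree : ∀ n {A A′ B B′} → Agree n A A′ → Agree n B B′ → Agree n (A ⊖ B) (A′ ⊖ B′)
⊖-Agree n A≈A′ B≈B′ i i<n = cong₂ ℤ._-_ (A≈A′ i i<n) (B≈B′ i i<n)

·-Agree : ∀ n c {A A′} → Agree n A A′ → Agree n (c · A) (c · A′)
·-Agree n c A≈A′ i i<n = cong (c ℤ.*_) (A≈A′ i i<n)

pow-Agree : ∀ n m {A A′} → Agree n A A′ → Agree n (pow A m) (pow A′ m)
pow-Agree n zero    A≈A′ = Agree-refl
pow-Agree n (suc m) A≈A′ = ⊛-Agree n A≈A′ (pow-Agree n m A≈A′)

inv-Agree : ∀ n {D D′} → Agree n D D′ → Agree n (inv D) (inv D′)
inv-Agree n D≈D′ i i<n =
  sumTo-cong i (λ m _ → pow-Agree n m (⊖-Agree n (Agree-refl {A = one}) D≈D′) i i<n)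

module _ {I : Set} (Φ : (I → Series) → I → Series)
  (Φ-contractive : ∀ n (X Y : I → Series) → (∀ x → Agree n (X x) (Y x)) →
                   ∀ x → Agree (suc n) (Φ X x) (Φ Y x)) where

  fixedPoint-unique : ∀ (X Y : I → Series) → (∀ x → X x ≋ Φ X x) → (∀ x → Y x ≋ Φ Y x) →
                      ∀ x → X x ≋ Y x
  fixedPoint-unique X Y X-fixed Y-fixed x n = agree (suc n) x n ℕ.≤-refl
    where
    agree : ∀ n x → Agree n (X x) (Y x)
    agree (suc n) x i i<1+n =
      trans (X-fixed x i) (trans (Φ-contractive n X Y (agree n) x i i<1+n) (sym (Y-fixed x i)))

-- Inverting a series with constant term 1

module _ (D : Series) (D₀≡1 : D 0 ≡ 1ℤ) where

  private
    E : Series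
    E = one ⊖ D

    E₀≡0 : E 0 ≡ 0ℤ
    E₀≡0 = cong (λ d → 1ℤ ℤ.- d) D₀≡1

    pow-low : ∀ m n → n < m → pow E m n ≡ 0ℤ
    pow-low (suc m) zero    _ = trans (cong (ℤ._* pow E m 0) E₀≡0) (ℤ.*-zeroˡ (pow E m 0))
    pow-low (suc m) (suc n) (s≤s n<m) = trans (⊛-suc E (pow E m) n)
      (cong₂ ℤ._+_ (trans (cong (ℤ._* pow E m (suc n)) E₀≡0) (ℤ.*-zeroˡ (pow E m (suc n))))
                   (sumTo-zero n _ (λ j _ → trans (cong (E (suc j) ℤ.*_)
                      (pow-low m (n ∸ j) (ℕ.≤-<-trans (ℕ.m∸n≤m n j) n<m))) (ℤ.*-zeroʳ (E (suc j))))))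

    partialInv : ℕ → Series
    partialInv N n = sumTo N (λ m → pow E m n)

    partialInv-suc : ∀ N n → n ≤ N → partialInv (suc N) n ≡ partialInv N n
    partialInv-suc N n n≤N =
      trans (cong (λ z → partialInv N n ℤ.+ z) (pow-low (suc N) n (s≤s n≤N))) (ℤ.+-identityʳ _)

    partialInv-stable : ∀ N n → n ≤ N → partialInv N n ≡ inv D n
    partialInv-stable N n n≤N =
      trans (cong (λ k → partialInv k n) (sym (ℕ.m∸n+n≡m n≤N))) (stable (N ∸ n))
      where
      stable : ∀ d → partialInv (d ℕ.+ n) n ≡ partialInv n n
      stable zero    = refl
      stable (suc d) = trans (partialInv-suc (d ℕ.+ n) n (ℕ.m≤n+m n d)) (stable d)

    ⊛-sumTo : ∀ N A (X : ℕ → Series) →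
              (A ⊛ (λ n → sumTo N (λ m → X m n))) ≋ (λ n → sumTo N (λ m → (A ⊛ X m) n))
    ⊛-sumTo zero    A X = ≋-refl
    ⊛-sumTo (suc N) A X =
      ≋-trans (distribˡ A (λ n → sumTo N (λ m → X m n)) (X (suc N)))
              (λ n → cong (ℤ._+ (A ⊛ X (suc N)) n) (⊛-sumTo N A X n))

    partialInv-rec : ∀ N → partialInv (suc N) ≋ (one ⊕ (E ⊛ partialInv N))
    partialInv-rec N n =
      trans (sumTo-sucˡ N (λ m → pow E m n)) (cong (λ z → one n ℤ.+ z) (sym (⊛-sumTo N E (pow E) n)))

  inv-fixedPoint : inv D ≋ (one ⊕ ((one ⊖ D) ⊛ inv D))
  inv-fixedPoint n = begin
    inv D n                                  ≡⟨ sym (partialInv-stable (suc n) n (ℕ.n≤1+n n)) ⟩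
    partialInv (suc n) n                     ≡⟨ partialInv-rec n n ⟩
    one n ℤ.+ (E ⊛ partialInv n) n           ≡⟨ cong (λ z → one n ℤ.+ z) (⊛-coefficient-cong n {E} {E}
                                                  (λ _ _ → refl)
                                                  (λ j j≤n → partialInv-stable n j j≤n)) ⟩
    one n ℤ.+ (E ⊛ inv D) n                  ∎
    where open ≡-Reasoning

  inv-inverseˡ : (inv D ⊛ D) ≋ one
  inv-inverseˡ = begin
    inv D ⊛ D                                    ≈⟨ *-cong (≋-refl {inv D}) D≋1-E ⟩
    inv D ⊛ (cst 1ℤ ⊖ E)                         ≈⟨ solve 2 (λ X e → X :* (con 1ℤ :- e)
                                                       := con 1ℤ :+ (X :- (con 1ℤ :+ e :* X)))
                                                     ≋-refl (inv D) E ⟩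
    cst 1ℤ ⊕ (inv D ⊖ (cst 1ℤ ⊕ (E ⊛ inv D)))    ≈⟨ +-cong cst-one (λ n → ℤ.i≡j⇒i-j≡0
                                                       (trans (inv-fixedPoint n)
                                                        (cong (ℤ._+ (E ⊛ inv D) n) (sym (cst-one n))))) ⟩
    one ⊕ 0S                                     ≈⟨ (λ n → ℤ.+-identityʳ (one n)) ⟩
    one                                          ∎
    where
    open SetoidReasoning setoid
    D≋1-E : D ≋ (cst 1ℤ ⊖ E)
    D≋1-E n = sym (trans (cong (ℤ._- E n) (cst-one n)) (a-[a-b]≡b (one n) (D n)))
      where a-[a-b]≡b : ∀ a b → a ℤ.- (a ℤ.- b) ≡ b
            a-[a-b]≡b = solve-∀

-- The continued fraction and the square root

module ContinuedFraction (f g h : ℕ → ℕ) (f₀≡0 : f 0 ≡ 0) (g₀≡0 : g 0 ≡ 0) (h₀≡0 : h 0 ≡ 0) where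

  open Formulas f g h public

  P : Series
  P = F ⊛ G

  U : Series
  U = one ⊖ H

  P₀≡0 : P 0 ≡ 0ℤ
  P₀≡0 = trans (cong (λ c → + c ℤ.* G 0) f₀≡0) (ℤ.*-zeroˡ (G 0))

  U₀≡1 : U 0 ≡ 1ℤ
  U₀≡1 = cong (λ c → 1ℤ ℤ.- + c) h₀≡0

  D-Agree : ∀ k j j′ → k ≤ j → k ≤ j′ → Agree k (D j) (D j′)
  D-Agree (suc k) (suc j) (suc j′) (s≤s k≤j) (s≤s k≤j′) =
    ⊖-Agree (suc k) (Agree-refl {A = U})
            (⊛-Agree-suc k P P₀≡0 (inv-Agree k (D-Agree k j j′ k≤j k≤j′)))

  -- All D j with j > n agree below order n + 1, so this is their coefficientwise limit.
  D∞ : Series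
  D∞ n = D (suc n) n

  D∞-Agree : ∀ k → Agree k D∞ (D k)
  D∞-Agree k i i<k = D-Agree (suc i) (suc i) k ℕ.≤-refl i<k i ℕ.≤-refl

  D∞-fixedPoint : D∞ ≋ (U ⊖ (P ⊛ inv D∞))
  D∞-fixedPoint n = trans
    (D-Agree (suc n) (suc n) (suc (suc n)) ℕ.≤-refl (ℕ.n≤1+n (suc n)) n ℕ.≤-refl)
    (⊖-Agree (suc (suc n)) (Agree-refl {A = U})
       (⊛-Agree-suc (suc n) P P₀≡0 (inv-Agree (suc n) (λ i i<1+n → sym (D∞-Agree (suc n) i i<1+n))))
       n (ℕ.n≤1+n (suc n)))

  D∞₀≡1 : D∞ 0 ≡ 1ℤ
  D∞₀≡1 = cong₂ ℤ._-_ U₀≡1 (trans (cong (ℤ._* inv (D 0) 0) P₀≡0) (ℤ.*-zeroˡ (inv (D 0) 0)))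

  M : Series
  M = inv D∞

  M-inverse : (M ⊛ (U ⊖ (P ⊛ M))) ≋ one
  M-inverse = ≋-trans (*-cong (≋-refl {M}) (≋-sym D∞-fixedPoint)) (inv-inverseˡ D∞ D∞₀≡1)

  T : Series
  T = U ⊖ ((+ 2) · (P ⊛ M))

  T₀≡1 : T 0 ≡ 1ℤ
  T₀≡1 = cong₂ ℤ._-_ U₀≡1 (cong (λ c → + 2 ℤ.* (c ℤ.* M 0)) P₀≡0)

  T-squared : (T ⊛ T) ≋ radicand
  T-squared = begin
    T ⊛ T                                                    ≈⟨ *-cong T≋ T≋ ⟩
    (U ⊖ (cst (+ 2) ⊛ (P ⊛ M))) ⊛ (U ⊖ (cst (+ 2) ⊛ (P ⊛ M)))
      ≈⟨ solve 3 (λ u p m → (u :- con (+ 2) :* (p :* m)) :* (u :- con (+ 2) :* (p :* m))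
                           := u :* u :- con (+ 4) :* (p :* (m :* (u :- p :* m))))
                 ≋-refl U P M ⟩
    (U ⊛ U) ⊖ (cst (+ 4) ⊛ (P ⊛ (M ⊛ (U ⊖ (P ⊛ M)))))
      ≈⟨ +-cong (≋-refl {U ⊛ U}) (-‿cong (*-cong (≋-refl {cst (+ 4)})
                                  (≋-trans (*-cong (≋-refl {P}) M-inverse) (⊛-identityʳ P)))) ⟩
    (U ⊛ U) ⊖ (cst (+ 4) ⊛ P)
      ≈⟨ +-cong (≋-refl {U ⊛ U}) (-‿cong (cst-⊛ (+ 4) P)) ⟩
    radicand                                                 ∎
    where
    open SetoidReasoning setoid
    T≋ : T ≋ (U ⊖ (cst (+ 2) ⊛ (P ⊛ M)))
    T≋ = +-cong (≋-refl {U}) (-‿cong (≋-sym (cst-⊛ (+ 2) (P ⊛ M))))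

  truncCF-Agree : ∀ k → Agree (suc k) (truncCF k) (inv T)
  truncCF-Agree k = inv-Agree (suc k) (⊖-Agree (suc k) (Agree-refl {A = U})
    (·-Agree (suc k) (+ 2) (⊛-Agree-suc k P P₀≡0 (inv-Agree k (λ i i<k → sym (D∞-Agree k i i<k))))))

-- Counting paths of the expanded automaton

sumBelow : ℕ → (ℕ → ℕ) → ℕ
sumBelow zero    u = 0
sumBelow (suc n) u = u 0 ℕ.+ sumBelow n (λ m → u (suc m))

sumBelow-cong : ∀ n {u v} → (∀ m → m < n → u m ≡ v m) → sumBelow n u ≡ sumBelow n v
sumBelow-cong zero    u≡v = refl
sumBelow-cong (suc n) u≡v =
  cong₂ ℕ._+_ (u≡v 0 (s≤s z≤n)) (sumBelow-cong n (λ m m<n → u≡v (suc m) (s≤s m<n)))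

sumTo-pos : ∀ n u → sumTo n (λ i → + u i) ≡ + (u 0 ℕ.+ sumBelow n (λ m → u (suc m)))
sumTo-pos zero    u = cong +_ (sym (ℕ.+-identityʳ (u 0)))
sumTo-pos (suc n) u = trans (sumTo-sucˡ n (λ i → + u i))
  (trans (cong (λ z → + u 0 ℤ.+ z) (sumTo-pos n (λ i → u (suc i)))) (sym (ℤ.pos-+ (u 0) _)))

Σ-Fin↔Fin-sumBelow : ∀ n (c : ℕ → ℕ) → (∀ m → n ≤ m → c m ≡ 0) →
                     Σ ℕ (λ m → Fin (c m)) ↔ Fin (sumBelow n c)
Σ-Fin↔Fin-sumBelow zero    c c≡0 =
  mk↔ₛ′ (λ { (m , k) → ⊥-elim (Fin.¬Fin0 (subst Fin (c≡0 m z≤n) k)) }) (λ ())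
        (λ ()) (λ { (m , k) → ⊥-elim (Fin.¬Fin0 (subst Fin (c≡0 m z≤n) k)) })
Σ-Fin↔Fin-sumBelow (suc n) c c≡0 = begin
  Σ ℕ (λ m → Fin (c m))                            ↔⟨ Σℕ-split ⟩
  (Fin (c 0) ⊎ Σ ℕ (λ m → Fin (c (suc m))))        ↔⟨ ↔-refl ⊎-↔ Σ-Fin↔Fin-sumBelow n (λ m → c (suc m))
                                                         (λ m n≤m → c≡0 (suc m) (s≤s n≤m)) ⟩
  (Fin (c 0) ⊎ Fin (sumBelow n (λ m → c (suc m)))) ↔⟨ ↔-sym Fin.+↔⊎ ⟩
  Fin (sumBelow (suc n) c)                         ∎
  where
  open EquationalReasoning {k = bijection}
  Σℕ-split : ∀ {X : ℕ → Set} → Σ ℕ X ↔ (X 0 ⊎ Σ ℕ (λ m → X (suc m)))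
  Σℕ-split = mk↔ₛ′ (λ { (zero , x) → inj₁ x ; (suc m , x) → inj₂ (m , x) })
                   (λ { (inj₁ x) → 0 , x ; (inj₂ (m , x)) → suc m , x })
                   (λ { (inj₁ x) → refl ; (inj₂ (m , x)) → refl })
                   (λ { (zero , x) → refl ; (suc m , x) → refl })

private
  ≡-irrelevant : ∀ {n} {i j : Fin n} (p q : i ≡ j) → p ≡ q
  ≡-irrelevant = Decidable⇒UIP.≡-irrelevant Fin._≟_

-- Where a hidden state can go next: to the following hidden state, or, from the
-- last position, out of the chain.
module _ {m : ℕ} {Q : Fin m → Set} {X : Set} where

  fromℕ-choice↔ : ((Σ (Fin m) λ r′ → (inject₁ r′ ≡ fromℕ m) × Q r′) ⊎ ((fromℕ m ≡ fromℕ m) × X)) ↔ X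
  fromℕ-choice↔ = mk↔ₛ′
    (λ { (inj₁ (r′ , eq , _)) → ⊥-elim (Fin.fromℕ≢inject₁ (sym eq)) ; (inj₂ (_ , x)) → x })
    (λ x → inj₂ (refl , x))
    (λ _ → refl)
    (λ { (inj₁ (r′ , eq , _)) → ⊥-elim (Fin.fromℕ≢inject₁ (sym eq))
       ; (inj₂ (eq , x)) → cong (λ eq → inj₂ (eq , x)) (≡-irrelevant refl eq) })

  inject₁-choice↔ : (r : Fin m) →
    ((Σ (Fin m) λ r′ → (inject₁ r′ ≡ inject₁ r) × Q r′) ⊎ ((fromℕ m ≡ inject₁ r) × X)) ↔ Q r
  inject₁-choice↔ r = mk↔ₛ′
    (λ { (inj₁ (r′ , eq , q)) → subst Q (Fin.inject₁-injective eq) q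
       ; (inj₂ (eq , _)) → ⊥-elim (Fin.fromℕ≢inject₁ eq) })
    (λ q → inj₁ (r , refl , q))
    (λ q → cong (λ eq → subst Q eq q) (≡-irrelevant (Fin.inject₁-injective {i = r} refl) refl))
    (λ { (inj₁ (r′ , eq , q)) → cong inj₁ (same-choice (Fin.inject₁-injective eq) eq q)
       ; (inj₂ (eq , _)) → ⊥-elim (Fin.fromℕ≢inject₁ eq) })
    where
    same-choice : ∀ {r′} (r′≡r : r′ ≡ r) (eq : inject₁ r′ ≡ inject₁ r) (q : Q r′) →
                  _≡_ {A = Σ (Fin m) λ r′ → (inject₁ r′ ≡ inject₁ r) × Q r′}
                      (r , refl , subst Q r′≡r q) (r′ , eq , q)
    same-choice refl eq q = cong (λ eq → r , eq , q) (≡-irrelevant refl eq)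

module Counting (f g h : ℕ → ℕ) where

  open BLin f g h

  upEdge : ℤ → Edge
  upEdge (+ i)    = up⁺ i
  upEdge -[1+ i ] = up⁻ i

  downEdge : ℤ → Edge
  downEdge (+ zero)  = down⁻ 0
  downEdge (+ suc i) = down⁺ i
  downEdge -[1+ i ]  = down⁻ (suc i)

  δ₀ : ℤ → ℕ
  δ₀ (+ zero)  = 1
  δ₀ (+ suc _) = 0
  δ₀ -[1+ _ ]  = 0

  data Position : (m : ℕ) → Fin (suc m) → Set where
    last  : ∀ {m} → Position m (fromℕ m)
    inner : ∀ {m} (r : Fin m) → Position m (inject₁ r)

  position : ∀ m r → Position m r
  position zero    zero    = last
  position (suc m) zero    = inner zero
  position (suc m) (suc r) with position m r
  ... | last    = last
  ... | inner r = inner (suc r)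

  -- paths x n counts the n-step paths from int x to int 0; pathsVia e n those
  -- of n + 1 steps whose first step enters a chain of e; pathsHid e m r n those
  -- from the hidden state r of a chain of e of length m + 2.
  mutual
    paths : ℤ → ℕ → ℕ
    paths x zero    = δ₀ x
    paths x (suc n) = pathsVia (loop x) n ℕ.+ (pathsVia (upEdge x) n ℕ.+ pathsVia (downEdge x) n)

    pathsVia : Edge → ℕ → ℕ
    pathsVia e n =
      lab e 1 ℕ.* paths (tgt e) n ℕ.+ sumBelow n (λ m → lab e (suc (suc m)) ℕ.* pathsHid e m zero n)

    pathsHid : Edge → (m : ℕ) → Fin (suc m) → ℕ → ℕ
    pathsHid e m r zero    = 0
    pathsHid e m r (suc n) = pathsHidAt e m n (position m r)

    pathsHidAt : Edge → (m : ℕ) → ℕ → ∀ {r} → Position m r → ℕ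
    pathsHidAt e m n last      = paths (tgt e) n
    pathsHidAt e m n (inner r) = pathsHid e m (suc r) n

  private
    suc-d+m≰m : ∀ d m → suc d ℕ.+ m ≤ m → ⊥
    suc-d+m≰m d m le = ℕ.m+1+n≰m m (subst (_≤ m) (ℕ.+-comm (suc d) m) le)

  pathsHid-short : ∀ e m r n → n ℕ.+ toℕ r ≤ m → pathsHid e m r n ≡ 0
  pathsHid-short e m r zero    _ = refl
  pathsHid-short e m r (suc n) le = short (position m r) le
    where
    short : ∀ {r} (p : Position m r) → suc n ℕ.+ toℕ r ≤ m → pathsHidAt e m n p ≡ 0
    short last      le = ⊥-elim (suc-d+m≰m n m (subst (λ k → suc n ℕ.+ k ≤ m) (Fin.toℕ-fromℕ m) le))
    short (inner r) le = pathsHid-short e m (suc r) n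
      (subst (_≤ m) (trans (cong (λ k → suc n ℕ.+ k) (Fin.toℕ-inject₁ r)) (sym (ℕ.+-suc n (toℕ r)))) le)

  pathsHid-exit : ∀ e d n m (r : Fin (suc m)) → d ℕ.+ toℕ r ≡ m →
                  pathsHid e m r (suc d ℕ.+ n) ≡ paths (tgt e) n
  pathsHid-exit e d n m r eq = walk d (position m r) eq
    where
    walk : ∀ d {r} (p : Position m r) → d ℕ.+ toℕ r ≡ m →
           pathsHidAt e m (d ℕ.+ n) p ≡ paths (tgt e) n
    walk zero    last      eq = refl
    walk (suc d) last      eq =
      ⊥-elim (suc-d+m≰m d m
        (ℕ.≤-reflexive (trans (cong (λ k → suc d ℕ.+ k) (sym (Fin.toℕ-fromℕ m))) eq)))
    walk zero    (inner r) eq = ⊥-elim (Fin.toℕ-inject₁-≢ r (sym eq))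
    walk (suc d) (inner r) eq = pathsHid-exit e d n m (suc r)
      (trans (ℕ.+-suc d (toℕ r)) (trans (cong (λ k → suc d ℕ.+ k) (sym (Fin.toℕ-inject₁ r))) eq))

  Out : State → (State → Set) → Set
  Out s P = Σ State (λ t → Step s t × P t)

  Path-suc↔Out : ∀ {s u n} → Path s u (suc n) ↔ Out s (λ t → Path t u n)
  Path-suc↔Out = mk↔ₛ′ (λ { (st ∷ p) → _ , st , p }) (λ { (t , st , p) → st ∷ p })
                       (λ { (t , st , p) → refl }) (λ { (st ∷ p) → refl })

  ChainStart : Edge → (State → Set) → Set
  ChainStart e P = (Fin (lab e 1) × P (int (tgt e)))
                 ⊎ Σ ℕ (λ m → Σ (Fin (lab e (suc (suc m)))) (λ k → P (hid e m k zero)))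

  IntOut : ℤ → (State → Set) → Set
  IntOut x P = ChainStart (loop x) P ⊎ (ChainStart (upEdge x) P ⊎ ChainStart (downEdge x) P)

  HidOut : ∀ e m → Fin (lab e (suc (suc m))) → Fin (suc m) → (State → Set) → Set
  HidOut e m k r P = (Σ (Fin m) λ r′ → (inject₁ r′ ≡ r) × P (hid e m k (suc r′)))
                   ⊎ ((fromℕ m ≡ r) × P (int (tgt e)))

  module _ (P : State → Set) where

    private
      byEdge : ∀ e → ChainStart e P → IntOut (src e) P
      byEdge (loop j)        c = inj₁ c
      byEdge (up⁺ i)         c = inj₂ (inj₁ c)
      byEdge (up⁻ i)         c = inj₂ (inj₁ c)
      byEdge (down⁺ i)       c = inj₂ (inj₂ c)
      byEdge (down⁻ zero)    c = inj₂ (inj₂ c)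
      byEdge (down⁻ (suc i)) c = inj₂ (inj₂ c)

      classify : ∀ {x} → Out (int x) P → IntOut x P
      classify (_ , single e k , p)  = byEdge e (inj₁ (k , p))
      classify (_ , enter e m k , p) = byEdge e (inj₂ (m , k , p))

      firstStep : ∀ e → ChainStart e P → Out (int (src e)) P
      firstStep e (inj₁ (k , p))     = _ , single e k , p
      firstStep e (inj₂ (m , k , p)) = _ , enter e m k , p

      unclassify : ∀ x → IntOut x P → Out (int x) P
      unclassify x        (inj₁ c)        = firstStep (loop x) c
      unclassify (+ i)    (inj₂ (inj₁ c)) = firstStep (up⁺ i) c
      unclassify -[1+ i ] (inj₂ (inj₁ c)) = firstStep (up⁻ i) c
      unclassify (+ zero)  (inj₂ (inj₂ c)) = firstStep (down⁻ 0) c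
      unclassify (+ suc i) (inj₂ (inj₂ c)) = firstStep (down⁺ i) c
      unclassify -[1+ i ]  (inj₂ (inj₂ c)) = firstStep (down⁻ (suc i)) c

      classify-unclassify : ∀ x (c : IntOut x P) → classify (unclassify x c) ≡ c
      classify-unclassify x         (inj₁ (inj₁ _))        = refl
      classify-unclassify x         (inj₁ (inj₂ _))        = refl
      classify-unclassify (+ i)     (inj₂ (inj₁ (inj₁ _))) = refl
      classify-unclassify (+ i)     (inj₂ (inj₁ (inj₂ _))) = refl
      classify-unclassify -[1+ i ]  (inj₂ (inj₁ (inj₁ _))) = refl
      classify-unclassify -[1+ i ]  (inj₂ (inj₁ (inj₂ _))) = refl
      classify-unclassify (+ zero)  (inj₂ (inj₂ (inj₁ _))) = refl
      classify-unclassify (+ zero)  (inj₂ (inj₂ (inj₂ _))) = refl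
      classify-unclassify (+ suc i) (inj₂ (inj₂ (inj₁ _))) = refl
      classify-unclassify (+ suc i) (inj₂ (inj₂ (inj₂ _))) = refl
      classify-unclassify -[1+ i ]  (inj₂ (inj₂ (inj₁ _))) = refl
      classify-unclassify -[1+ i ]  (inj₂ (inj₂ (inj₂ _))) = refl

      unclassify-classify : ∀ {x} (o : Out (int x) P) → unclassify x (classify o) ≡ o
      unclassify-classify (_ , single (loop j) k , p)          = refl
      unclassify-classify (_ , single (up⁺ i) k , p)           = refl
      unclassify-classify (_ , single (up⁻ i) k , p)           = refl
      unclassify-classify (_ , single (down⁺ i) k , p)         = refl
      unclassify-classify (_ , single (down⁻ zero) k , p)      = refl
      unclassify-classify (_ , single (down⁻ (suc i)) k , p)   = refl
      unclassify-classify (_ , enter (loop j) m k , p)         = refl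
      unclassify-classify (_ , enter (up⁺ i) m k , p)          = refl
      unclassify-classify (_ , enter (up⁻ i) m k , p)          = refl
      unclassify-classify (_ , enter (down⁺ i) m k , p)        = refl
      unclassify-classify (_ , enter (down⁻ zero) m k , p)     = refl
      unclassify-classify (_ , enter (down⁻ (suc i)) m k , p)  = refl

    Out-int↔ : ∀ x → Out (int x) P ↔ IntOut x P
    Out-int↔ x = mk↔ₛ′ classify (unclassify x) (classify-unclassify x) unclassify-classify

    Out-hid↔ : ∀ {e m k r} → Out (hid e m k r) P ↔ HidOut e m k r P
    Out-hid↔ {e} {m} {k} = mk↔ₛ′
      (λ { (_ , move _ _ _ r′ , p) → inj₁ (r′ , refl , p) ; (_ , exit _ _ _ , p) → inj₂ (refl , p) })
      (λ { (inj₁ (r′ , refl , p)) → _ , move e m k r′ , p ; (inj₂ (refl , p)) → _ , exit e m k , p })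
      (λ { (inj₁ (r′ , refl , p)) → refl ; (inj₂ (refl , p)) → refl })
      (λ { (_ , move _ _ _ r′ , p) → refl ; (_ , exit _ _ _ , p) → refl })

  ToZero : ℕ → State → Set
  ToZero n t = Path t (int 0ℤ) n

  Path-zero↔ : ∀ x → ToZero 0 (int x) ↔ Fin (δ₀ x)
  Path-zero↔ (+ zero)  = mk↔ₛ′ (λ _ → zero) (λ _ → []) (λ { zero → refl }) (λ { [] → refl })
  Path-zero↔ (+ suc i) = mk↔ₛ′ (λ ()) (λ ()) (λ ()) (λ ())
  Path-zero↔ -[1+ i ]  = mk↔ₛ′ (λ ()) (λ ()) (λ ()) (λ ())

  mutual
    paths↔ : ∀ x n → ToZero n (int x) ↔ Fin (paths x n)
    paths↔ x zero    = Path-zero↔ x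
    paths↔ x (suc n) = begin
      ToZero (suc n) (int x)                    ↔⟨ Path-suc↔Out ⟩
      Out (int x) (ToZero n)                    ↔⟨ Out-int↔ (ToZero n) x ⟩
      IntOut x (ToZero n)                       ↔⟨ pathsVia↔ (loop x) n ⊎-↔ (pathsVia↔ (upEdge x) n
                                                                      ⊎-↔ pathsVia↔ (downEdge x) n) ⟩
      (Fin (pathsVia (loop x) n) ⊎ (Fin (pathsVia (upEdge x) n) ⊎ Fin (pathsVia (downEdge x) n)))
                                                ↔⟨ ↔-refl ⊎-↔ ↔-sym Fin.+↔⊎ ⟩
      (Fin (pathsVia (loop x) n) ⊎ Fin (pathsVia (upEdge x) n ℕ.+ pathsVia (downEdge x) n))
                                                ↔⟨ ↔-sym Fin.+↔⊎ ⟩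
      Fin (paths x (suc n))                     ∎
      where open EquationalReasoning {k = bijection}

    pathsVia↔ : ∀ e n → ChainStart e (ToZero n) ↔ Fin (pathsVia e n)
    pathsVia↔ e n = begin
      ChainStart e (ToZero n)
        ↔⟨ (↔-refl ×-↔ paths↔ (tgt e) n) ⊎-↔ Σ-↔ ↔-refl (Σ-↔ ↔-refl (pathsHid↔ e _ _ zero n)) ⟩
      ((Fin (lab e 1) × Fin (paths (tgt e) n))
         ⊎ Σ ℕ (λ m → Fin (lab e (suc (suc m))) × Fin (pathsHid e m zero n)))
        ↔⟨ ↔-sym Fin.*↔× ⊎-↔ Σ-↔ ↔-refl (↔-sym Fin.*↔×) ⟩
      (Fin (lab e 1 ℕ.* paths (tgt e) n) ⊎ Σ ℕ (λ m → Fin (chains m)))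
        ↔⟨ ↔-refl ⊎-↔ Σ-Fin↔Fin-sumBelow n chains chains-vanish ⟩
      (Fin (lab e 1 ℕ.* paths (tgt e) n) ⊎ Fin (sumBelow n chains))
        ↔⟨ ↔-sym Fin.+↔⊎ ⟩
      Fin (pathsVia e n) ∎
      where
      open EquationalReasoning {k = bijection}
      chains : ℕ → ℕ
      chains m = lab e (suc (suc m)) ℕ.* pathsHid e m zero n
      chains-vanish : ∀ m → n ≤ m → chains m ≡ 0
      chains-vanish m n≤m = trans
        (cong (lab e (suc (suc m)) ℕ.*_)
              (pathsHid-short e m zero n (subst (_≤ m) (sym (ℕ.+-identityʳ n)) n≤m)))
        (ℕ.*-zeroʳ (lab e (suc (suc m))))

    pathsHid↔ : ∀ e m k r n → ToZero n (hid e m k r) ↔ Fin (pathsHid e m r n)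
    pathsHid↔ e m k r zero    = mk↔ₛ′ (λ ()) (λ ()) (λ ()) (λ ())
    pathsHid↔ e m k r (suc n) = pathsHidAt↔ e m k n (position m r)

    pathsHidAt↔ : ∀ e m k n {r} (p : Position m r) →
                  ToZero (suc n) (hid e m k r) ↔ Fin (pathsHidAt e m n p)
    pathsHidAt↔ e m k n p =
      ↔-trans Path-suc↔Out (↔-trans (Out-hid↔ (ToZero n)) (next p))
      where
      next : ∀ {r} (p : Position m r) → HidOut e m k r (ToZero n) ↔ Fin (pathsHidAt e m n p)
      next last      = ↔-trans fromℕ-choice↔ (paths↔ (tgt e) n)
      next (inner r) = ↔-trans (inject₁-choice↔ r) (pathsHid↔ e m k (suc r) n)

  pathsHid-enter : ∀ e m n → m < n → pathsHid e m zero n ≡ paths (tgt e) (n ∸ suc m)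
  pathsHid-enter e m n m<n = trans (cong (pathsHid e m zero) (sym (ℕ.m+[n∸m]≡n m<n)))
                                   (pathsHid-exit e m (n ∸ suc m) m zero (ℕ.+-identityʳ m))

-- The generating functions of the states

module GeneratingFunction (f g h : ℕ → ℕ) (f₀≡0 : f 0 ≡ 0) (g₀≡0 : g 0 ≡ 0) (h₀≡0 : h 0 ≡ 0) where

  open BLin f g h using (Edge; up⁺; up⁻; down⁺; down⁻; loop; tgt; lab)
  open Counting f g h
  open ContinuedFraction f g h f₀≡0 g₀≡0 h₀≡0

  lab₀≡0 : ∀ e → lab e 0 ≡ 0
  lab₀≡0 (up⁺ _)   = f₀≡0
  lab₀≡0 (up⁻ _)   = f₀≡0
  lab₀≡0 (down⁺ _) = g₀≡0
  lab₀≡0 (down⁻ _) = g₀≡0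
  lab₀≡0 (loop _)  = h₀≡0

  -- Decomposition of a path by the chain containing its first transition.
  System : (ℤ → Series) → ℤ → Series
  System Y x = cst (+ δ₀ x) ⊕ (via (loop x) ⊕ (via (upEdge x) ⊕ via (downEdge x)))
    where
    via : Edge → Series
    via e = ↑ (lab e) ⊛ Y (tgt e)

  System-contractive : ∀ n (X Y : ℤ → Series) → (∀ x → Agree n (X x) (Y x)) →
                       ∀ x → Agree (suc n) (System X x) (System Y x)
  System-contractive n X Y X≈Y x =
    ⊕-Agree (suc n) (Agree-refl {A = cst (+ δ₀ x)})
      (⊕-Agree (suc n) (via (loop x)) (⊕-Agree (suc n) (via (upEdge x)) (via (downEdge x))))
    where
    via : ∀ e → Agree (suc n) (↑ (lab e) ⊛ X (tgt e)) (↑ (lab e) ⊛ Y (tgt e))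
    via e = ⊛-Agree-suc n (↑ (lab e)) (cong +_ (lab₀≡0 e)) (X≈Y (tgt e))

  W : ℤ → Series
  W x n = + paths x n

  via-suc : ∀ e n → (↑ (lab e) ⊛ W (tgt e)) (suc n) ≡ + pathsVia e n
  via-suc e n = begin
    (↑ (lab e) ⊛ W (tgt e)) (suc n)
      ≡⟨ ⊛-suc (↑ (lab e)) (W (tgt e)) n ⟩
    + lab e 0 ℤ.* W (tgt e) (suc n) ℤ.+ (tail (↑ (lab e)) ⊛ W (tgt e)) n
      ≡⟨ cong (ℤ._+ (tail (↑ (lab e)) ⊛ W (tgt e)) n)
              (trans (cong (λ c → + c ℤ.* W (tgt e) (suc n)) (lab₀≡0 e)) (ℤ.*-zeroˡ (W (tgt e) (suc n)))) ⟩
    0ℤ ℤ.+ (tail (↑ (lab e)) ⊛ W (tgt e)) n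
      ≡⟨ ℤ.+-identityˡ _ ⟩
    sumTo n (λ i → + lab e (suc i) ℤ.* + paths (tgt e) (n ∸ i))
      ≡⟨ sumTo-cong n (λ i _ → sym (ℤ.pos-* (lab e (suc i)) (paths (tgt e) (n ∸ i)))) ⟩
    sumTo n (λ i → + (lab e (suc i) ℕ.* paths (tgt e) (n ∸ i)))
      ≡⟨ sumTo-pos n (λ i → lab e (suc i) ℕ.* paths (tgt e) (n ∸ i)) ⟩
    + (lab e 1 ℕ.* paths (tgt e) n ℕ.+ sumBelow n (λ m → lab e (suc (suc m)) ℕ.* paths (tgt e) (n ∸ suc m)))
      ≡⟨ cong (λ s → + (lab e 1 ℕ.* paths (tgt e) n ℕ.+ s))
              (sumBelow-cong n (λ m m<n → cong (lab e (suc (suc m)) ℕ.*_) (sym (pathsHid-enter e m n m<n)))) ⟩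
    + pathsVia e n ∎
    where open ≡-Reasoning

  W-solves : ∀ x → W x ≋ System W x
  W-solves x zero = sym (trans
    (cong (λ z → + δ₀ x ℤ.+ z)
          (cong₂ ℤ._+_ (via₀ (loop x)) (cong₂ ℤ._+_ (via₀ (upEdge x)) (via₀ (downEdge x)))))
    (ℤ.+-identityʳ _))
    where
    via₀ : ∀ e → (↑ (lab e) ⊛ W (tgt e)) 0 ≡ 0ℤ
    via₀ e = trans (cong (λ c → + c ℤ.* W (tgt e) 0) (lab₀≡0 e)) (ℤ.*-zeroˡ (W (tgt e) 0))
  W-solves x (suc n) = sym (trans (ℤ.+-identityˡ _)
    (trans (cong₂ ℤ._+_ (via-suc (loop x) n) (cong₂ ℤ._+_ (via-suc (upEdge x) n) (via-suc (downEdge x) n)))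
    (trans (cong (λ z → + pathsVia (loop x) n ℤ.+ z) (sym (ℤ.pos-+ (pathsVia (upEdge x) n) _)))
           (sym (ℤ.pos-+ (pathsVia (loop x) n) _)))))

  B : Series
  B = inv T

  V : ℤ → Series
  V (+ i)    = pow (M ⊛ G) i ⊛ B
  V -[1+ i ] = pow (M ⊛ F) (suc i) ⊛ B

  private
    M-inverse′ : (M ⊛ ((cst 1ℤ ⊖ H) ⊖ (P ⊛ M))) ≋ one
    M-inverse′ = ≋-trans
      (*-cong (≋-refl {M}) (+-cong (+-cong cst-one (≋-refl {neg H})) (≋-refl {neg (P ⊛ M)})))
      M-inverse

    B-inverse′ : (B ⊛ ((cst 1ℤ ⊖ H) ⊖ (cst (+ 2) ⊛ (P ⊛ M)))) ≋ cst 1ℤ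
    B-inverse′ = ≋-trans (*-cong (≋-refl {B}) T≋) (≋-trans (inv-inverseˡ T T₀≡1) (≋-sym cst-one))
      where
      T≋ : ((cst 1ℤ ⊖ H) ⊖ (cst (+ 2) ⊛ (P ⊛ M))) ≋ T
      T≋ = +-cong (+-cong cst-one (≋-refl {neg H})) (-‿cong (cst-⊛ (+ 2) (P ⊛ M)))

    pow-suc-⊛ : ∀ A k → (pow A (suc k) ⊛ B) ≋ (A ⊛ (pow A k ⊛ B))
    pow-suc-⊛ A k = ⊛-assoc A (pow A k) B

    pow-one-⊛ : ∀ A → (pow A 1 ⊛ B) ≋ (A ⊛ B)
    pow-one-⊛ A = *-cong (⊛-identityʳ A) (≋-refl {B})

    V-neg : ∀ i → V (ℤ.- (+ i)) ≋ (pow (M ⊛ F) i ⊛ B)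
    V-neg zero    = ≋-refl
    V-neg (suc i) = ≋-refl

  -- In each case the constant 1 is replaced by a product that equals it
  -- (M-inverse′ or B-inverse′); what remains is a ring identity.
  V-solves : ∀ x → V x ≋ System V x
  V-solves (+ zero) = begin
    one ⊛ B                                                      ≈⟨ ⊛-identityˡ B ⟩
    B                                                            ≈⟨ solve 5
      (λ b hh ff gg m → b := b :* ((con 1ℤ :- hh) :- con (+ 2) :* (ff :* gg :* m))
                             :+ (hh :* b :+ (ff :* (m :* gg :* b) :+ gg :* (m :* ff :* b))))
      ≋-refl B H F G M ⟩
    (B ⊛ ((cst 1ℤ ⊖ H) ⊖ (cst (+ 2) ⊛ (P ⊛ M))))
      ⊕ ((H ⊛ B) ⊕ ((F ⊛ ((M ⊛ G) ⊛ B)) ⊕ (G ⊛ ((M ⊛ F) ⊛ B))))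
      ≈⟨ +-cong B-inverse′ (+-cong (*-cong (≋-refl {H}) (≋-sym (⊛-identityˡ B)))
           (+-cong (*-cong (≋-refl {F}) (≋-sym (pow-one-⊛ (M ⊛ G))))
                   (*-cong (≋-refl {G}) (≋-sym (pow-one-⊛ (M ⊛ F)))))) ⟩
    System V (+ zero)                                            ∎
    where open SetoidReasoning setoid
  V-solves (+ suc i) = begin
    pow (M ⊛ G) (suc i) ⊛ B                                     ≈⟨ pow-suc-⊛ (M ⊛ G) i ⟩
    (M ⊛ G) ⊛ X                                                    ≈⟨ solve 5
      (λ m gg ff hh x → m :* gg :* x := con 0ℤ :+ (hh :* (m :* gg :* x) :+ (ff :* (m :* gg :* (m :* gg :* x))
                                         :+ (m :* ((con 1ℤ :- hh) :- ff :* gg :* m)) :* (gg :* x))))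
      ≋-refl M G F H X ⟩
    cst 0ℤ ⊕ ((H ⊛ ((M ⊛ G) ⊛ X)) ⊕ ((F ⊛ ((M ⊛ G) ⊛ ((M ⊛ G) ⊛ X)))
                                 ⊕ ((M ⊛ ((cst 1ℤ ⊖ H) ⊖ (P ⊛ M))) ⊛ (G ⊛ X))))
      ≈⟨ +-cong (≋-refl {cst 0ℤ}) (+-cong (*-cong (≋-refl {H}) (≋-sym (pow-suc-⊛ (M ⊛ G) i)))
           (+-cong (*-cong (≋-refl {F}) (≋-sym (≋-trans (pow-suc-⊛ (M ⊛ G) (suc i))
                                                         (*-cong (≋-refl {M ⊛ G}) (pow-suc-⊛ (M ⊛ G) i)))))
                   (≋-trans (*-cong M-inverse′ (≋-refl {G ⊛ X})) (⊛-identityˡ (G ⊛ X))))) ⟩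
    System V (+ suc i)                                           ∎
    where
    open SetoidReasoning setoid
    X : Series
    X = pow (M ⊛ G) i ⊛ B
  V-solves -[1+ i ] = begin
    pow (M ⊛ F) (suc i) ⊛ B                                     ≈⟨ pow-suc-⊛ (M ⊛ F) i ⟩
    (M ⊛ F) ⊛ X                                                    ≈⟨ solve 5
      (λ m ff gg hh x → m :* ff :* x := con 0ℤ :+ (hh :* (m :* ff :* x)
                                         :+ ((m :* ((con 1ℤ :- hh) :- ff :* gg :* m)) :* (ff :* x)
                                         :+ gg :* (m :* ff :* (m :* ff :* x)))))
      ≋-refl M F G H X ⟩
    cst 0ℤ ⊕ ((H ⊛ ((M ⊛ F) ⊛ X)) ⊕ (((M ⊛ ((cst 1ℤ ⊖ H) ⊖ (P ⊛ M))) ⊛ (F ⊛ X))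
                                 ⊕ (G ⊛ ((M ⊛ F) ⊛ ((M ⊛ F) ⊛ X)))))
      ≈⟨ +-cong (≋-refl {cst 0ℤ}) (+-cong (*-cong (≋-refl {H}) (≋-sym (pow-suc-⊛ (M ⊛ F) i)))
           (+-cong (≋-trans (*-cong M-inverse′ (≋-refl {F ⊛ X})) (≋-trans (⊛-identityˡ (F ⊛ X))
                                                                  (*-cong (≋-refl {F}) (≋-sym (V-neg i)))))
                   (*-cong (≋-refl {G}) (≋-sym (≋-trans (pow-suc-⊛ (M ⊛ F) (suc i))
                                                         (*-cong (≋-refl {M ⊛ F}) (pow-suc-⊛ (M ⊛ F) i))))))) ⟩
    System V -[1+ i ]                                            ∎
    where
    open SetoidReasoning setoid
    X : Series
    X = pow (M ⊛ F) i ⊛ B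

  W₀≋B : W 0ℤ ≋ B
  W₀≋B = ≋-trans (fixedPoint-unique System System-contractive W V W-solves V-solves 0ℤ) (⊛-identityˡ B)

mainTheorem8 : (f g h : ℕ → ℕ) → f 0 ≡ 0 → g 0 ≡ 0 → h 0 ≡ 0 →
    Σ (ℕ → ℕ) λ a →
      ((n : ℕ) → BLin.AccPath f g h n ↔ Fin (a n))
      × (Σ Series λ S →
           (S 0 ≡ 1ℤ)
           × ((n : ℕ) → (S ⊛ S) n ≡ Formulas.radicand f g h n)
           × ((n : ℕ) → (↑ a ⊛ S) n ≡ one n))
      × ((n : ℕ) → ∃ λ K → (k : ℕ) → K ≤ k → Formulas.truncCF f g h k n ≡ + (a n))
mainTheorem8 f g h f₀≡0 g₀≡0 h₀≡0 =
    paths 0ℤ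
  , paths↔ 0ℤ
  , (T , T₀≡1 , T-squared , ≋-trans (*-cong W₀≋B (≋-refl {T})) (inv-inverseˡ T T₀≡1))
  , λ n → n , λ k n≤k → trans (truncCF-Agree k n (s≤s n≤k)) (sym (W₀≋B n))
  where
  open Counting f g h using (paths; paths↔)
  open ContinuedFraction f g h f₀≡0 g₀≡0 h₀≡0 using (T; T₀≡1; T-squared; truncCF-Agree)
  open GeneratingFunction f g h f₀≡0 g₀≡0 h₀≡0 using (W₀≋B)
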